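{- Let $[G,f,\cdot]$ be a monotone-contractive (MC) system on a finite graph $G$ with vertex set $V=\{1,\dots,n\}$ and finite linearly ordered state set $P$. For any two fair update schedules $W$ and $W'$, every system state $x\in P^n$ reaches the same fixed point $z\in P^n$ under $[G,f,W]$ and under $[G,f,W']$. In addition, any state $y\in P^n$ with $z\le y\le x$ reaches the fixed point $z$.
   Context: Let $G=(V,E)$ be a finite graph with $V=\{1,\dots,n\}$, and let $P$ be a finite set with a linear order $\le$. Each vertex $i$ has a state $x_i\in P$ and a local function $f_i$ which takes as arguments the state of $i$ and the states of its neighbors and returns a new state of $i$. $P^q$ is ordered componentwise: $(x_1,\dots,x_q)\le(y_1,\dots,y_q)$ iff $x_j\le y_j$ for all $j$. A function $g\colon P^q\to P$ is monotone if $x\le y$ implies $g(x)\le g(y)$. A local function $f_i\colon(x_i,x_{k_1},\dots,x_{k_r})\mapsto x_i'$ is contractive if $x_i'\le x_i$ for every argument. An MC system is one in which all local functions are monotone and contractive. A fair update schedule is an infinite sequence $W=W_1W_2\cdots$ of subsets $W_j\subseteq V$ such that for every $k\ge 1$ and every vertex $i$ there is $l>k$ with $i\in W_l$. Given an initial state $x^{(0)}=x$, the state $x^{(j)}$ ($j>0$) is obtained from $x^{(j-1)}$ by letting every vertex $i\in W_j$ take the new state $f_i$ evaluated on the states in $x^{(j-1)}$ of $i$ and its neighbors, while vertices not in $W_j$ keep their states; write $[G,f,W]^{(j)}(x)=x^{(j)}$. A state $x$ reaches a fixed point $z$ if there is $k\ge 0$ such that $[G,f,W]^{(j)}(x)=[G,f,W]^{(k)}(x)=z$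 for all $j>k$. -}

module Defs where

open import Level using (Level; _⊔_)
open import Data.Nat as ℕ using (ℕ; zero; suc)
open import Data.Fin using (Fin)
open import Data.Fin.Subset using (Subset; _∈_)
open import Data.Vec using (Vec; lookup; tabulate)
open import Data.Product using (Σ; ∃; _×_)
open import Data.Bool using (if_then_else_)
open import Relation.Nullary using (¬_; does)
open import Relation.Binary using (Rel; IsDecTotalOrder)
open import Relation.Binary.PropositionalEquality using (_≡_)
open import Function.Bundles using (_↔_)
open import Data.Fin.Subset.Properties using (_∈?_)

-- A finite graph on vertex set V = Fin n (vertices 0..n-1 stand for 1..n):
-- a symmetric, irreflexive adjacency relation.
record Graph (n : ℕ) : Set₁ where
  field
    Adj   : Fin n → Fin n → Set
    sym   : ∀ {i j} → Adj i j → Adj j i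
    irrefl : ∀ {i} → ¬ Adj i i

record FinLinOrder (c ℓ : Level) : Set (Level.suc (c ⊔ ℓ)) where
  field
    Carrier : Set c
    _≤_     : Rel Carrier ℓ
    isDecTotalOrder : IsDecTotalOrder _≡_ _≤_
    finite  : Σ ℕ λ m → Carrier ↔ Fin m

module _ {c ℓ : Level} (P : FinLinOrder c ℓ) where
  open FinLinOrder P

  State : ℕ → Set c
  State n = Vec Carrier n

  _≤ˢ_ : ∀ {n} → State n → State n → Set ℓ
  x ≤ˢ y = ∀ i → lookup x i ≤ lookup y i

  -- A family of local functions: f i computes the new state of vertex i.
  -- It is given the whole system state, but is required (Local) to depend
  -- only on the states of i and its neighbours.
  LocalFuns : ℕ → Set c
  LocalFuns n = Fin n → State n → Carrier

  Local : ∀ {n} → Graph n → LocalFuns n → Set c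
  Local G f = ∀ i (x y : State _) → lookup x i ≡ lookup y i →
              (∀ j → Graph.Adj G i j → lookup x j ≡ lookup y j) →
              f i x ≡ f i y

  Monotone : ∀ {n} → Graph n → LocalFuns n → Set (c ⊔ ℓ)
  Monotone G f = ∀ i (x y : State _) → lookup x i ≤ lookup y i →
                 (∀ j → Graph.Adj G i j → lookup x j ≤ lookup y j) →
                 f i x ≤ f i y

  Contractive : ∀ {n} → LocalFuns n → Set (c ⊔ ℓ)
  Contractive f = ∀ i x → f i x ≤ lookup x i

  IsMC : ∀ {n} → Graph n → LocalFuns n → Set (c ⊔ ℓ)
  IsMC G f = Local G f × Monotone G f × Contractive f

  -- Update schedules W = W₁ W₂ …; the value at index 0 is unused.
  Schedule : ℕ → Set
  Schedule n = ℕ → Subset n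

  Fair : ∀ {n} → Schedule n → Set
  Fair W = ∀ k → 1 ℕ.≤ k → ∀ i → ∃ λ l → k ℕ.< l × i ∈ W l

  step : ∀ {n} → LocalFuns n → Subset n → State n → State n
  step f U x = tabulate λ i → if does (i ∈? U) then f i x else lookup x i

  run : ∀ {n} → LocalFuns n → Schedule n → State n → ℕ → State n
  run f W x zero    = x
  run f W x (suc j) = step f (W (suc j)) (run f W x j)

  Reaches : ∀ {n} → LocalFuns n → Schedule n → State n → State n → Set c
  Reaches f W x z = ∃ λ k → run f W x k ≡ z × (∀ j → k ℕ.< j → run f W x j ≡ z)

  FixedPoint : ∀ {n} → LocalFuns n → State n → Set c
  FixedPoint f z = ∀ i → f i z ≡ lookup z i

-- Under a contractive map a run only descends, and by monotonicity every fixed point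
-- below the initial state x stays below the whole run. While some vertex is not fixed,
-- fairness eventually updates it, strictly lowering the weight (the sum of the ranks
-- of the vertex states); so every run stops, at a fixed point below x that dominates
-- all others: the greatest fixed point below x, which does not depend on the schedule.
-- For z ≤ y ≤ x it is also the greatest fixed point below y.
module Submission where

open import Defs
open import Level using (_⊔_)
open import Data.Nat as ℕ using (ℕ; zero; suc; z≤n; s≤s; _<_; _+_)
open import Data.Nat.Properties using (m≤n⇒m≤1+n; +-mono-≤; +-mono-<-≤; +-mono-≤-<; <⇒≤; ≤⇒≤′)
open import Data.Nat.Induction using (<-wellFounded)
open import Induction.WellFounded using (Acc; acc)
open import Data.Product using (∃; _×_; _,_; proj₂)
open import Data.Sum using (_⊎_; inj₁; inj₂)
open import Data.Fin as Fin using ()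
open import Data.Fin.Subset using () renaming (_∈_ to _∈ₛ_)
open import Data.Fin.Subset.Properties using (_∈?_)
open import Data.Fin.Properties using (all?; ¬∀⟶∃¬)
open import Data.Vec using ([]; _∷_; lookup; tabulate)
open import Data.Vec.Properties using (lookup∘tabulate; tabulate∘lookup; tabulate-cong)
open import Data.List using (List; map; allFin) renaming ([] to []ₗ; _∷_ to _∷ₗ_)
open import Data.List.Membership.Propositional using (_∈_)
open import Data.List.Membership.Propositional.Properties using (∈-allFin; ∈-map⁺)
open import Data.List.Relation.Unary.Any using (here; there)
open import Data.Bool using (if_then_else_)
open import Relation.Nullary using (yes; no; does)
open import Relation.Nullary.Negation using (contradiction)
open import Relation.Binary using (IsDecTotalOrder)
open import Relation.Binary.PropositionalEquality
open import Function.Base using (_∘_)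
open import Function.Bundles using (Inverse)

module _ {c ℓ} (P : FinLinOrder c ℓ) where
  open FinLinOrder P
  open IsDecTotalOrder isDecTotalOrder
    using (antisym; _≤?_; _≟_) renaming (refl to ≤-refl; trans to ≤-trans)

  ≤ˢ-refl : ∀ {k} (x : State P k) → _≤ˢ_ P x x
  ≤ˢ-refl _ i = ≤-refl

  ≤ˢ-trans : ∀ {k} (x y z : State P k) → _≤ˢ_ P x y → _≤ˢ_ P y z → _≤ˢ_ P x z
  ≤ˢ-trans _ _ _ x≤y y≤z i = ≤-trans (x≤y i) (y≤z i)

  ≤ˢ-antisym : ∀ {k} {x y : State P k} → _≤ˢ_ P x y → _≤ˢ_ P y x → x ≡ y
  ≤ˢ-antisym {x = x} {y} x≤y y≤x = begin
    x                   ≡⟨ tabulate∘lookup x ⟨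
    tabulate (lookup x) ≡⟨ tabulate-cong (λ i → antisym (x≤y i) (y≤x i)) ⟩
    tabulate (lookup y) ≡⟨ tabulate∘lookup y ⟩
    y                   ∎
    where open ≡-Reasoning

  countBelow : Carrier → List Carrier → ℕ
  countBelow p []ₗ       = 0
  countBelow p (q ∷ₗ qs) = if does (q ≤? p) then suc (countBelow p qs) else countBelow p qs

  countBelow-mono : ∀ {p p′} → p ≤ p′ → ∀ qs → countBelow p qs ℕ.≤ countBelow p′ qs
  countBelow-mono p≤p′ []ₗ = z≤n
  countBelow-mono {p} {p′} p≤p′ (q ∷ₗ qs) with q ≤? p | q ≤? p′
  ... | yes _   | yes _    = s≤s (countBelow-mono p≤p′ qs)
  ... | yes q≤p | no q≰p′  = contradiction (≤-trans q≤p p≤p′) q≰p′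
  ... | no _    | yes _    = m≤n⇒m≤1+n (countBelow-mono p≤p′ qs)
  ... | no _    | no _     = countBelow-mono p≤p′ qs

  countBelow-strict : ∀ {p p′} → p ≤ p′ → p ≢ p′ → ∀ {qs} → p′ ∈ qs →
                      countBelow p qs < countBelow p′ qs
  countBelow-strict {p} {p′} p≤p′ p≢p′ {q ∷ₗ qs} (here refl) with q ≤? p | q ≤? p′
  ... | yes p′≤p | _       = contradiction (antisym p≤p′ p′≤p) p≢p′
  ... | no _     | yes _   = s≤s (countBelow-mono p≤p′ qs)
  ... | no _     | no p′≰p′ = contradiction ≤-refl p′≰p′
  countBelow-strict {p} {p′} p≤p′ p≢p′ {q ∷ₗ qs} (there p′∈qs) with q ≤? p | q ≤? p′
  ... | yes _   | yes _   = s≤s (countBelow-strict p≤p′ p≢p′ p′∈qs)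
  ... | yes q≤p | no q≰p′ = contradiction (≤-trans q≤p p≤p′) q≰p′
  ... | no _    | yes _   = m≤n⇒m≤1+n (countBelow-strict p≤p′ p≢p′ p′∈qs)
  ... | no _    | no _    = countBelow-strict p≤p′ p≢p′ p′∈qs

  elements : List Carrier
  elements = map (Inverse.from enum) (allFin _)
    where enum = proj₂ finite

  ∈-elements : ∀ p → p ∈ elements
  ∈-elements p = subst (_∈ elements) (Inverse.strictlyInverseʳ enum p)
                   (∈-map⁺ (Inverse.from enum) (∈-allFin (Inverse.to enum p)))
    where enum = proj₂ finite

  rank : Carrier → ℕ
  rank p = countBelow p elements

  rank-mono : ∀ {p p′} → p ≤ p′ → rank p ℕ.≤ rank p′
  rank-mono p≤p′ = countBelow-mono p≤p′ elements

  rank-strict : ∀ {p p′} → p ≤ p′ → p ≢ p′ → rank p < rank p′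
  rank-strict p≤p′ p≢p′ = countBelow-strict p≤p′ p≢p′ (∈-elements _)

  weight : ∀ {k} → State P k → ℕ
  weight []      = 0
  weight (p ∷ x) = rank p + weight x

  weight-mono : ∀ {k} (x y : State P k) → _≤ˢ_ P x y → weight x ℕ.≤ weight y
  weight-mono []      []      x≤y = z≤n
  weight-mono (_ ∷ x) (_ ∷ y) x≤y =
    +-mono-≤ (rank-mono (x≤y Fin.zero)) (weight-mono x y (x≤y ∘ Fin.suc))

  weight-strict : ∀ {k} (x y : State P k) → _≤ˢ_ P x y →
                  ∀ i → lookup x i ≢ lookup y i → weight x < weight y
  weight-strict (_ ∷ x) (_ ∷ y) x≤y Fin.zero    xᵢ≢yᵢ =
    +-mono-<-≤ (rank-strict (x≤y Fin.zero) xᵢ≢yᵢ) (weight-mono x y (x≤y ∘ Fin.suc))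
  weight-strict (_ ∷ x) (_ ∷ y) x≤y (Fin.suc i) xᵢ≢yᵢ =
    +-mono-≤-< (rank-mono (x≤y Fin.zero)) (weight-strict x y (x≤y ∘ Fin.suc) i xᵢ≢yᵢ)

  fixed-or-moving : ∀ {n} (f : LocalFuns P n) (x : State P n) →
                    FixedPoint P f x ⊎ ∃ λ i → f i x ≢ lookup x i
  fixed-or-moving {n} f x with all? (λ i → f i x ≟ lookup x i)
  ... | yes fixed  = inj₁ fixed
  ... | no unfixed = inj₂ (¬∀⟶∃¬ n _ (λ i → f i x ≟ lookup x i) unfixed)

module Dynamics {c ℓ} (P : FinLinOrder c ℓ) {n} (G : Graph n) (f : LocalFuns P n)
                (mono : Monotone P G f) (contr : Contractive P f) where
  open FinLinOrder P
  open IsDecTotalOrder isDecTotalOrder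
    using (antisym) renaming (refl to ≤-refl; reflexive to ≤-reflexive)

  private
    _⊑_ : State P n → State P n → Set ℓ
    _⊑_ = _≤ˢ_ P

    Fixed : State P n → Set c
    Fixed = FixedPoint P f

  f-mono : ∀ i {x y} → x ⊑ y → f i x ≤ f i y
  f-mono i x⊑y = mono i _ _ (x⊑y i) (λ j _ → x⊑y j)

  lookup-step : ∀ U x i → lookup (step P f U x) i ≡ (if does (i ∈? U) then f i x else lookup x i)
  lookup-step U x i = lookup∘tabulate _ i

  step-∈ : ∀ {U} x {i} → i ∈ₛ U → lookup (step P f U x) i ≡ f i x
  step-∈ {U} x {i} i∈U rewrite lookup-step U x i with i ∈? U
  ... | yes _   = refl
  ... | no i∉U  = contradiction i∈U i∉U

  step-⊑ : ∀ U x → step P f U x ⊑ x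
  step-⊑ U x i rewrite lookup-step U x i with i ∈? U
  ... | yes _ = contr i x
  ... | no _  = ≤-refl

  step-fixed : ∀ U {z} → Fixed z → step P f U z ≡ z
  step-fixed U {z} fixed = ≤ˢ-antisym P (step-⊑ U z) z⊑step
    where
    z⊑step : z ⊑ step P f U z
    z⊑step i rewrite lookup-step U z i with i ∈? U
    ... | yes _ = ≤-reflexive (sym (fixed i))
    ... | no _  = ≤-refl

  step-above-fixed : ∀ U {w x} → Fixed w → w ⊑ x → w ⊑ step P f U x
  step-above-fixed U {w} {x} fixed w⊑x i rewrite lookup-step U x i with i ∈? U
  ... | yes _ = subst (_≤ f i x) (fixed i) (f-mono i w⊑x)
  ... | no _  = w⊑x i

  step-weight-< : ∀ {U s t i} → s ⊑ t → i ∈ₛ U → f i t ≢ lookup t i →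
                  weight P (step P f U s) < weight P t
  step-weight-< {U} {s} {t} {i} s⊑t i∈U moves =
    weight-strict P s′ t (≤ˢ-trans P s′ s t (step-⊑ U s) s⊑t) i changed
    where
    s′ = step P f U s
    changed : lookup s′ i ≢ lookup t i
    changed eq = moves (antisym (contr i t)
      (subst (_≤ f i t) (trans (sym (step-∈ s i∈U)) eq) (f-mono i s⊑t)))

  module _ (W : Schedule P n) (x : State P n) where
    private
      r : ℕ → State P n
      r = run P f W x

    run-antitone : ∀ {k j} → k ℕ.≤′ j → r j ⊑ r k
    run-antitone {k} ℕ.≤′-refl                 = ≤ˢ-refl P (r k)
    run-antitone {k} {suc j} (ℕ.≤′-step k≤′j) =
      ≤ˢ-trans P (r (suc j)) (r j) (r k) (step-⊑ _ (r j)) (run-antitone k≤′j)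

    run-⊑ : ∀ k → r k ⊑ x
    run-⊑ k = run-antitone {0} {k} (≤⇒≤′ z≤n)

    run-above-fixed : ∀ {w} → Fixed w → w ⊑ x → ∀ k → w ⊑ r k
    run-above-fixed fixed w⊑x zero    = w⊑x
    run-above-fixed fixed w⊑x (suc k) = step-above-fixed _ fixed (run-above-fixed fixed w⊑x k)

    run-stays-fixed : ∀ {k j} → Fixed (r k) → k ℕ.≤′ j → r j ≡ r k
    run-stays-fixed fixed ℕ.≤′-refl        = refl
    run-stays-fixed fixed (ℕ.≤′-step k≤′j) rewrite run-stays-fixed fixed k≤′j = step-fixed _ fixed

    reaches-fixed : ∀ k → Fixed (r k) → Reaches P f W x (r k)
    reaches-fixed k fixed = k , refl , λ j k<j → run-stays-fixed fixed (≤⇒≤′ (<⇒≤ k<j))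

  module _ {W : Schedule P n} (fair : Fair P W) where

    eventually-fixed : ∀ x → ∃ λ k → Fixed (run P f W x k)
    eventually-fixed x = go 0 (<-wellFounded _)
      where
      r = run P f W x

      -- Some vertex i is not yet fixed at time k; fairness updates it at a later
      -- time l + 1, and the run has only decreased meanwhile, so the weight drops.
      go : ∀ k → Acc _<_ (weight P (r k)) → ∃ λ k′ → Fixed (r k′)
      go k (acc rec) with fixed-or-moving P f (r k)
      ... | inj₁ fixed         = k , fixed
      ... | inj₂ (i , moves) with fair (suc k) (s≤s z≤n) i
      ... | suc l , s≤s k<l , i∈W =
        go (suc l) (rec (step-weight-< (run-antitone W x (≤⇒≤′ (<⇒≤ k<l))) i∈W moves))

  record IsGreatestFixedPointBelow (x z : State P n) : Set (c ⊔ ℓ) where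
    field
      fixed    : Fixed z
      below    : z ⊑ x
      greatest : ∀ {w} → Fixed w → w ⊑ x → w ⊑ z

  greatestFixedPointBelow : ∀ {W} → Fair P W → ∀ x → ∃ (IsGreatestFixedPointBelow x)
  greatestFixedPointBelow {W} fair x with eventually-fixed fair x
  ... | k , fixed = run P f W x k , record
    { fixed    = fixed
    ; below    = run-⊑ W x k
    ; greatest = λ fixedʷ w⊑x → run-above-fixed W x fixedʷ w⊑x k
    }

  reaches-greatestFixedPointBelow : ∀ {W x z} → Fair P W →
                                    IsGreatestFixedPointBelow x z → Reaches P f W x z
  reaches-greatestFixedPointBelow {W} {x} fair gfp with eventually-fixed fair x
  ... | k , fixed = subst (Reaches P f W x) limit≡z (reaches-fixed W x k fixed)
    where
    open IsGreatestFixedPointBelow gfp renaming (fixed to fixedᶻ)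
    limit≡z : run P f W x k ≡ _
    limit≡z = ≤ˢ-antisym P (greatest fixed (run-⊑ W x k)) (run-above-fixed W x fixedᶻ below k)

  isGreatestFixedPointBelow-between : ∀ {x y z} → IsGreatestFixedPointBelow x z →
                                      z ⊑ y → y ⊑ x → IsGreatestFixedPointBelow y z
  isGreatestFixedPointBelow-between {x} {y} gfp z⊑y y⊑x = record
    { fixed    = fixed
    ; below    = z⊑y
    ; greatest = λ {w} fixedʷ w⊑y → greatest fixedʷ (≤ˢ-trans P w y x w⊑y y⊑x)
    }
    where open IsGreatestFixedPointBelow gfp

theorem2 : ∀ {c ℓ} (P : FinLinOrder c ℓ) (n : ℕ) (G : Graph n) (f : LocalFuns P n) →
    IsMC P G f →
    (W W′ : Schedule P n) → Fair P W → Fair P W′ →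
    (x : State P n) →
    ∃ λ z → FixedPoint P f z × Reaches P f W x z × Reaches P f W′ x z ×
    (∀ y → _≤ˢ_ P z y → _≤ˢ_ P y x → Reaches P f W y z × Reaches P f W′ y z)
theorem2 P n G f (_ , mono , contr) W W′ fair fair′ x =
  let open Dynamics P G f mono contr renaming (reaches-greatestFixedPointBelow to reaches)
      z , gfp = greatestFixedPointBelow fair x
  in z , IsGreatestFixedPointBelow.fixed gfp , reaches fair gfp , reaches fair′ gfp ,
     λ y z≤y y≤x → let gfpʸ = isGreatestFixedPointBelow-between gfp z≤y y≤x
                   in reaches fair gfpʸ , reaches fair′ gfpʸ
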